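{- Let $n\geq1$, $m\geq2$ and let $\ell_a,\ell_b$ be integers with $0\leq\ell_a,\ell_b\leq m^n$ and $\ell_a+\ell_b\geq m^n$. Then $q_{n,m}(\ell_a+\ell_b-m^n)$ equals either $q_{n,m}(\ell_a)+q_{n,m}(\ell_b)-m$ or $q_{n,m}(\ell_a)+q_{n,m}(\ell_b)-m+1$.
   Context: The corner vertices of the Sierpinski graph $S(n,m)$ (vertex set $\{0,\dots,m-1\}^n$) are $i^n=(i,\dots,i)$ for $0\leq i\leq m-1$. With $Lex(v)=1+\sum_{j=1}^n v_jm^{n-j}$, $q_{n,m}(\ell)$ is the number of corner vertices $v$ with $Lex(v)\leq\ell$. -}

module Defs where

open import Data.Nat using (ℕ; zero; suc; _+_; _*_; _^_; _≤?_)
open import Data.Fin using (Fin; toℕ)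
open import Data.Vec using (Vec; []; _∷_; replicate)
open import Data.List using (length; filter)
open import Data.List.Base using (allFin)

-- A vertex of the Sierpinski graph S(n,m) is a word (v_1,...,v_n) over {0,...,m-1}.
Vertex : ℕ → ℕ → Set
Vertex n m = Vec (Fin m) n

lexSum : ∀ {n m} → Vertex n m → ℕ
lexSum {zero}  {m} []       = 0
lexSum {suc n} {m} (x ∷ xs) = toℕ x * m ^ n + lexSum xs

Lex : ∀ {n m} → Vertex n m → ℕ
Lex v = suc (lexSum v)

corner : (n m : ℕ) → Fin m → Vertex n m
corner n m i = replicate n i

q : (n m : ℕ) → ℕ → ℕ
q n m ℓ = length (filter (λ i → Lex (corner n m i) ≤? ℓ) (allFin m))

-- The corner i^n has Lex value 1 + i·r, where r = 1 + m + ⋯ + m^(n-1) satisfies m^n = 1 + (m-1)·r.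
-- Hence q(ℓ) = ⌈ℓ/r⌉ for 0 ≤ ℓ ≤ m^n.  Writing c = ℓa + ℓb - m^n, we get c + (m-1)·r = ℓa + ℓb - 1,
-- so q(c) + (m-1) = ⌈(ℓa + ℓb - 1)/r⌉, and for any a, b ≥ 0 with a + b ≥ 1 the ceiling
-- ⌈(a + b - 1)/r⌉ is either ⌈a/r⌉ + ⌈b/r⌉ or one less.
module Submission where

open import Defs

-- A separate module, so that ℕ's _+_ is not in scope alongside ℤ's _+_ of the statement.
module CornerCounting where

  open import Data.Nat
  open import Data.Nat.Properties
  open import Data.Fin using (Fin; toℕ; zero; suc)
  open import Data.Vec using (replicate)
  open import Data.List using (length; filter; tabulate)
  open import Data.List.Properties using (filter-accept; filter-reject)
  open import Data.Product using (Σ; _,_; proj₂)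
  open import Data.Sum using (_⊎_; inj₁; inj₂; [_,_]′; map)
  open import Function using (id; _∘_)
  open import Function.Bundles using (_⇔_; mk⇔; module Equivalence)
  open Equivalence using (to; from)
  open import Relation.Nullary using (yes; no)
  open import Relation.Unary using (Pred; Decidable)
  open import Relation.Binary.PropositionalEquality using (_≡_; refl; sym; trans; cong; subst; module ≡-Reasoning)
  open import Data.Nat.Tactic.RingSolver using (solve-∀)

  repunit : ℕ → ℕ → ℕ
  repunit zero    m = 0
  repunit (suc n) m = m ^ n + repunit n m

  repunit-positive : ∀ {n} m .{{_ : NonZero m}} → 1 ≤ n → 0 < repunit n m
  repunit-positive {suc n} m _ = <-≤-trans (m^n>0 m n) (m≤m+n (m ^ n) (repunit n m))

  lexSum-replicate : ∀ n {m} (i : Fin m) → lexSum (replicate n i) ≡ toℕ i * repunit n m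
  lexSum-replicate zero        i = sym (*-zeroʳ (toℕ i))
  lexSum-replicate (suc n) {m} i = begin
    toℕ i * m ^ n + lexSum (replicate n i)  ≡⟨ cong (toℕ i * m ^ n +_) (lexSum-replicate n i) ⟩
    toℕ i * m ^ n + toℕ i * repunit n m     ≡⟨ *-distribˡ-+ (toℕ i) (m ^ n) (repunit n m) ⟨
    toℕ i * repunit (suc n) m               ∎
    where open ≡-Reasoning

  suc^≡1+*repunit : ∀ n k → suc k ^ n ≡ suc (k * repunit n (suc k))
  suc^≡1+*repunit zero    k = cong suc (sym (*-zeroʳ k))
  suc^≡1+*repunit (suc n) k rewrite suc^≡1+*repunit n k = expand k (repunit n (suc k))
    where
    expand : ∀ k r → suc k * suc (k * r) ≡ suc (k * (suc (k * r) + r))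
    expand = solve-∀

  record IsCeilDiv (ℓ r t : ℕ) : Set where
    constructor isCeilDiv
    field
      lower : ℓ ≤ t * r
      upper : t * r < ℓ + r

  isCeilDiv-exists : ∀ ℓ r .{{_ : NonZero r}} → Σ ℕ (IsCeilDiv ℓ r)
  isCeilDiv-exists zero    r = 0 , isCeilDiv z≤n (>-nonZero⁻¹ r)
  isCeilDiv-exists (suc ℓ) r with isCeilDiv-exists ℓ r
  ... | t , isCeilDiv ℓ≤tr tr<ℓ+r with ℓ <? t * r
  ...   | yes ℓ<tr = t , isCeilDiv ℓ<tr (m<n⇒m<1+n tr<ℓ+r)
  ...   | no  ℓ≮tr rewrite ≤-antisym ℓ≤tr (≮⇒≥ ℓ≮tr) =
    suc t , isCeilDiv (+-monoˡ-≤ (t * r) (>-nonZero⁻¹ r)) (s≤s (≤-reflexive (+-comm r (t * r))))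

  isCeilDiv-≤ : ∀ {ℓ r t u} → IsCeilDiv ℓ r t → ℓ ≤ u * r → t ≤ u
  isCeilDiv-≤ {ℓ} {r} {t} {u} (isCeilDiv _ tr<ℓ+r) ℓ≤ur = s≤s⁻¹ (*-cancelʳ-< r t (suc u) (begin-strict
    t * r   <⟨ tr<ℓ+r ⟩
    ℓ + r   ≤⟨ +-monoˡ-≤ r ℓ≤ur ⟩
    u * r + r ≡⟨ +-comm (u * r) r ⟩
    suc u * r ∎))
    where open ≤-Reasoning

  isCeilDiv-*<⇔< : ∀ {ℓ r t j} → IsCeilDiv ℓ r t → j * r < ℓ ⇔ j < t
  isCeilDiv-*<⇔< {ℓ} {r} {t} {j} (isCeilDiv ℓ≤tr tr<ℓ+r) = mk⇔
    (λ jr<ℓ → *-cancelʳ-< r j t (<-≤-trans jr<ℓ ℓ≤tr))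
    (λ j<t → +-cancelʳ-< r (j * r) ℓ (begin-strict
      j * r + r ≡⟨ +-comm (j * r) r ⟩
      suc j * r ≤⟨ *-monoˡ-≤ r j<t ⟩
      t * r     <⟨ tr<ℓ+r ⟩
      ℓ + r     ∎))
    where open ≤-Reasoning

  isCeilDiv-+* : ∀ {ℓ r t} j → IsCeilDiv ℓ r t → IsCeilDiv (ℓ + j * r) r (t + j)
  isCeilDiv-+* {ℓ} {r} {t} j (isCeilDiv ℓ≤tr tr<ℓ+r) = isCeilDiv
    (begin
      ℓ + j * r       ≤⟨ +-monoˡ-≤ (j * r) ℓ≤tr ⟩
      t * r + j * r   ≡⟨ *-distribʳ-+ r t j ⟨
      (t + j) * r     ∎)
    (begin-strict
      (t + j) * r     ≡⟨ *-distribʳ-+ r t j ⟩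
      t * r + j * r   <⟨ +-monoˡ-< (j * r) tr<ℓ+r ⟩
      ℓ + r + j * r   ≡⟨ +-assoc ℓ r (j * r) ⟩
      ℓ + (r + j * r) ≡⟨ cong (ℓ +_) (+-comm r (j * r)) ⟩
      ℓ + (j * r + r) ≡⟨ +-assoc ℓ (j * r) r ⟨
      ℓ + j * r + r   ∎)
    where open ≤-Reasoning

  isCeilDiv-+ : ∀ {a b d r ta tb s} → IsCeilDiv a r ta → IsCeilDiv b r tb → IsCeilDiv d r s →
                a + b ≡ suc d → suc s ≡ ta + tb ⊎ s ≡ ta + tb
  isCeilDiv-+ {a} {b} {d} {r} {ta} {tb} {s}
              (isCeilDiv a≤tar tar<a+r) (isCeilDiv b≤tbr tbr<b+r) ⌈d⌉@(isCeilDiv d≤sr _) a+b≡1+d =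
    [ (λ ta+tb<1+s → inj₂ (≤-antisym s≤ta+tb (s≤s⁻¹ ta+tb<1+s))) , inj₁ ∘ sym ]′ (m≤n⇒m<n∨m≡n ta+tb≤1+s)
    where
    open ≤-Reasoning
    s≤ta+tb : s ≤ ta + tb
    s≤ta+tb = isCeilDiv-≤ ⌈d⌉ (<⇒≤ (begin-strict
      d                   <⟨ ≤-reflexive (sym a+b≡1+d) ⟩
      a + b               ≤⟨ +-mono-≤ a≤tar b≤tbr ⟩
      ta * r + tb * r     ≡⟨ *-distribʳ-+ r ta tb ⟨
      (ta + tb) * r       ∎))
    ta+tb≤1+s : ta + tb ≤ suc s
    ta+tb≤1+s = s≤s⁻¹ (*-cancelʳ-< r (ta + tb) (2 + s) (s≤s⁻¹ (begin
      suc (suc ((ta + tb) * r))       ≡⟨ cong (2 +_) (*-distribʳ-+ r ta tb) ⟩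
      suc (suc (ta * r + tb * r))     ≡⟨ cong suc (+-suc (ta * r) (tb * r)) ⟨
      suc (ta * r) + suc (tb * r)     ≤⟨ +-mono-≤ tar<a+r tbr<b+r ⟩
      (a + r) + (b + r)               ≡⟨ rearrange a b r ⟩
      (a + b) + (r + r)               ≡⟨ cong (_+ (r + r)) a+b≡1+d ⟩
      suc d + (r + r)                 ≤⟨ +-monoˡ-≤ (r + r) (s≤s d≤sr) ⟩
      suc (s * r) + (r + r)           ≡⟨ collect (s * r) r ⟩
      suc ((2 + s) * r)               ∎)))
      where
      rearrange : ∀ a b r → (a + r) + (b + r) ≡ (a + b) + (r + r)
      rearrange = solve-∀
      collect : ∀ x r → suc x + (r + r) ≡ suc (r + (r + x))
      collect = solve-∀

  length-filter-tabulate : ∀ {a p} {A : Set a} {P : Pred A p} (P? : Decidable P) {k t} (f : Fin k → A) →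
                           t ≤ k → (∀ i → P (f i) ⇔ toℕ i < t) → length (filter P? (tabulate f)) ≡ t
  length-filter-tabulate P? {zero} f z≤n _ = refl
  length-filter-tabulate P? {suc k} {zero} f _ P⇔<0 =
    trans (cong length (filter-reject P? ((λ ()) ∘ to (P⇔<0 zero))))
          (length-filter-tabulate P? (f ∘ suc) z≤n
            (λ i → mk⇔ ((λ ()) ∘ to (P⇔<0 (suc i))) (λ ())))
  length-filter-tabulate P? {suc k} {suc t} f t<1+k P⇔<1+t =
    trans (cong length (filter-accept P? (from (P⇔<1+t zero) z<s)))
          (cong suc (length-filter-tabulate P? (f ∘ suc) (s≤s⁻¹ t<1+k)
            (λ i → mk⇔ (s<s⁻¹ ∘ to (P⇔<1+t (suc i))) (from (P⇔<1+t (suc i)) ∘ s<s))))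

  q≡ceilDiv : ∀ n k {ℓ t} → 1 ≤ n → ℓ ≤ suc k ^ n → IsCeilDiv ℓ (repunit n (suc k)) t → q n (suc k) ℓ ≡ t
  q≡ceilDiv n k {ℓ} {t} 1≤n ℓ≤m^n ⌈ℓ⌉ =
    length-filter-tabulate (λ i → Lex (corner n (suc k) i) ≤? ℓ) id (isCeilDiv-≤ ⌈ℓ⌉ ℓ≤[1+k]r) Lex≤⇔<t
    where
    r = repunit n (suc k)
    ℓ≤[1+k]r : ℓ ≤ suc k * r
    ℓ≤[1+k]r = begin
      ℓ            ≤⟨ ℓ≤m^n ⟩
      suc k ^ n    ≡⟨ suc^≡1+*repunit n k ⟩
      suc (k * r)  ≤⟨ +-monoˡ-≤ (k * r) (repunit-positive (suc k) 1≤n) ⟩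
      r + k * r    ∎
      where open ≤-Reasoning
    Lex≤⇔<t : ∀ i → Lex (corner n (suc k) i) ≤ ℓ ⇔ toℕ i < t
    Lex≤⇔<t i = subst (λ x → x < ℓ ⇔ toℕ i < t) (sym (lexSum-replicate n i)) (isCeilDiv-*<⇔< ⌈ℓ⌉)

  q-isCeilDiv : ∀ n k {ℓ} → 1 ≤ n → ℓ ≤ suc k ^ n → IsCeilDiv ℓ (repunit n (suc k)) (q n (suc k) ℓ)
  q-isCeilDiv n k {ℓ} 1≤n ℓ≤m^n = subst (IsCeilDiv ℓ r) (sym (q≡ceilDiv n k 1≤n ℓ≤m^n ⌈ℓ⌉)) ⌈ℓ⌉
    where
    r = repunit n (suc k)
    instance
      r-nonZero : NonZero r
      r-nonZero = >-nonZero (repunit-positive (suc k) 1≤n)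
    ⌈ℓ⌉ = proj₂ (isCeilDiv-exists ℓ r)

  q-+ : ∀ n k {ℓa ℓb ℓc} → 1 ≤ n → ℓa ≤ suc k ^ n → ℓb ≤ suc k ^ n → ℓc + suc k ^ n ≡ ℓa + ℓb →
        q n (suc k) ℓc + suc k ≡ q n (suc k) ℓa + q n (suc k) ℓb
        ⊎ q n (suc k) ℓc + suc k ≡ suc (q n (suc k) ℓa + q n (suc k) ℓb)
  q-+ n k {ℓa} {ℓb} {ℓc} 1≤n ℓa≤m^n ℓb≤m^n ℓc+m^n≡ℓa+ℓb =
    map (trans (+-suc s k)) (trans (+-suc s k) ∘ cong suc)
      (isCeilDiv-+ (q-isCeilDiv n k 1≤n ℓa≤m^n) (q-isCeilDiv n k 1≤n ℓb≤m^n)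
                   (isCeilDiv-+* k (q-isCeilDiv n k 1≤n ℓc≤m^n)) ℓa+ℓb≡1+ℓc+kr)
    where
    r = repunit n (suc k)
    s = q n (suc k) ℓc
    ℓc≤m^n : ℓc ≤ suc k ^ n
    ℓc≤m^n = +-cancelʳ-≤ (suc k ^ n) ℓc (suc k ^ n)
               (subst (_≤ suc k ^ n + suc k ^ n) (sym ℓc+m^n≡ℓa+ℓb) (+-mono-≤ ℓa≤m^n ℓb≤m^n))
    ℓa+ℓb≡1+ℓc+kr : ℓa + ℓb ≡ suc (ℓc + k * r)
    ℓa+ℓb≡1+ℓc+kr = begin
      ℓa + ℓb            ≡⟨ ℓc+m^n≡ℓa+ℓb ⟨
      ℓc + suc k ^ n     ≡⟨ cong (ℓc +_) (suc^≡1+*repunit n k) ⟩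
      ℓc + suc (k * r)   ≡⟨ +-suc ℓc (k * r) ⟩
      suc (ℓc + k * r)   ∎
      where open ≡-Reasoning

open import Data.Nat using (ℕ; _≤_; _^_) renaming (_+_ to _+ℕ_; _∸_ to _∸ℕ_)
open import Data.Integer using (ℤ; +_; _+_; _-_)
open import Data.Sum using (_⊎_)
open import Relation.Binary.PropositionalEquality using (_≡_)

open import Data.Nat using (suc; s≤s)
open import Data.Nat.Properties using (m∸n+n≡m; m+n∸n≡m; m≤n+m)
open import Data.Integer.Properties using (m-n≡m⊖n; ⊖-≥)
open import Data.Integer.Tactic.RingSolver using (solve-∀)
open import Data.Sum using (map)
open import Relation.Binary.PropositionalEquality using (refl; sym; trans; cong)
open CornerCounting using (q-+)

m+n≡o⇒+m≡+o-+n : ∀ {m n o} → m +ℕ n ≡ o → + m ≡ + o - + n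
m+n≡o⇒+m≡+o-+n {m} {n} refl =
  sym (trans (m-n≡m⊖n (m +ℕ n) n) (trans (⊖-≥ (m≤n+m n m)) (cong +_ (m+n∸n≡m m n))))

m+n≡1+o⇒+m≡+o-+n+1 : ∀ {m n o} → m +ℕ n ≡ suc o → + m ≡ (+ o - + n) + + 1
m+n≡1+o⇒+m≡+o-+n+1 {n = n} {o = o} eq = trans (m+n≡o⇒+m≡+o-+n eq) (pull-out-1 (+ o) (+ n))
  where
  pull-out-1 : ∀ x y → (+ 1 + x) - y ≡ (x - y) + + 1
  pull-out-1 = solve-∀

lemma8 : (n m ℓa ℓb : ℕ) → 1 ≤ n → 2 ≤ m →
         ℓa ≤ m ^ n → ℓb ≤ m ^ n → m ^ n ≤ ℓa +ℕ ℓb →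
         (+ q n m ((ℓa +ℕ ℓb) ∸ℕ m ^ n) ≡ (+ q n m ℓa + + q n m ℓb) - + m)
         ⊎ (+ q n m ((ℓa +ℕ ℓb) ∸ℕ m ^ n) ≡ ((+ q n m ℓa + + q n m ℓb) - + m) + + 1)
lemma8 n (suc k) ℓa ℓb 1≤n (s≤s _) ℓa≤m^n ℓb≤m^n m^n≤ℓa+ℓb =
  map m+n≡o⇒+m≡+o-+n m+n≡1+o⇒+m≡+o-+n+1 (q-+ n k 1≤n ℓa≤m^n ℓb≤m^n (m∸n+n≡m m^n≤ℓa+ℓb))
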